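{- Let $(\vec G=(V,E),\sigma)$ be a binary-explainable best match graph with $|V|\ge 2$, and let $\mathscr V$ be the partition of $V$ into the vertex sets of the connected components of the Aho graph $[\mathscr R^{\mathrm B}(\vec G,\sigma),V]$. Then $|\mathscr V|\ge 2$ and $c(\vec G,\mathscr V)=0$.
   Context: A digraph $\vec G=(V,E)$ has a finite vertex set and arc set $E\subseteq (V\times V)\setminus\{(v,v)\mid v\in V\}$. All rooted trees are phylogenetic (every non-leaf vertex has at least two children); a tree is binary if every non-leaf vertex has exactly two children; $L(T)$ is the leaf set, $\rho_T$ the root, $T(v)$ the subtree rooted at $v$, $\mathrm{child}_T(v)$ the children of $v$; $u\preceq_T v$ means $v$ lies on the path from $u$ to the root; $\mathrm{lca}_T$ is the last common ancestor. For a tree $T$ with leaf coloring $\sigma$, a leaf $y$ is a best match of a leaf $x$ if $\sigma(x)\ne\sigma(y)$ and $\mathrm{lca}_T(x,y)\preceq_T\mathrm{lca}_T(x,y')$ for all leaves $y'$ with $\sigma(y')=\sigma(y)$; the best match graph $\vec G(T,\sigma)$ has vertex set $L(T)$, coloring $\sigma$, and arcs $(x,y)$ whenever $y$ is a best match of $x$. A properly colored digraph is a binary-explainable best match graph if it equals $\vec G(T,\sigma)$ for some binary tree $T$. A triple $xy|z$ on distinct leaves is displayed by $T$ if $\mathrm{lca}_T(x,y)\prec_T\mathrm{lca}_T(x,z)$. Informative triples: $\mathscr R(\vec G,\sigma)=\{ab|b'\colon \sigma(a)\ne\sigma(b)=\sigma(b'),\ (a,b)\in E,\ (a,b')\notin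 E\}$; forbidden triples: $\mathscr F(\vec G,\sigma)=\{ab|b'\colon \sigma(a)\ne\sigma(b)=\sigma(b'),\ b\ne b',\ (a,b),(a,b')\in E\}$; $\mathscr R^{\mathrm B}(\vec G,\sigma)=\mathscr R(\vec G,\sigma)\cup\{bb'|a\colon ab|b'\in\mathscr F(\vec G,\sigma)\}$. For a triple set $\mathscr R$, the Aho graph $[\mathscr R,V]$ is the undirected graph on $V$ with edge $xy$ iff $xy|z\in\mathscr R$ for some $z\in V$. For a tree $T$ with $L(T)=V$, $U(\vec G,T)=E\triangle E(\vec G(T,\sigma))$; for a partition $\mathscr V$ of $V$ with $|\mathscr V|\ge 2$, $\mathscr T(\mathscr V)$ is the set of phylogenetic trees $T$ with $L(T)=V$ and $\{L(T(v))\mid v\in\mathrm{child}_T(\rho_T)\}=\mathscr V$, $U(\vec G,\mathscr V)=\bigcap_{T\in\mathscr T(\mathscr V)}U(\vec G,T)$, and $c(\vec G,\mathscr V)=|U(\vec G,\mathscr V)|$. -}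

module Defs where

open import Data.Nat using (ℕ; zero; suc; _≤_)
open import Data.Fin using (Fin)
open import Data.List using (List; []; _∷_; _++_; length)
open import Data.Maybe using (Maybe; just; nothing)
open import Data.Product using (Σ; ∃; ∃-syntax; _×_; _,_)
open import Data.Sum using (_⊎_)
open import Relation.Nullary using (¬_)
open import Relation.Binary.PropositionalEquality using (_≡_; _≢_)
open import Relation.Binary.Construct.Closure.ReflexiveTransitive using (Star)

-- Rooted trees with leaves labelled by Fin n.
-- A vertex of a tree is addressed by its path from the root
-- (list of child indices).

data Tree (n : ℕ) : Set where
  leaf : Fin n → Tree n
  node : List (Tree n) → Tree n

mutual
  subtree : ∀ {n} → Tree n → List ℕ → Maybe (Tree n)
  subtree t [] = just t
  subtree (leaf x) (i ∷ p) = nothing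
  subtree (node ts) (i ∷ p) = subtreeL ts i p

  subtreeL : ∀ {n} → List (Tree n) → ℕ → List ℕ → Maybe (Tree n)
  subtreeL [] i p = nothing
  subtreeL (t ∷ ts) zero p = subtree t p
  subtreeL (t ∷ ts) (suc i) p = subtreeL ts i p

module _ {n : ℕ} (T : Tree n) where

  IsVertex : List ℕ → Set
  IsVertex p = ∃[ s ] subtree T p ≡ just s

  LeafAt : Fin n → List ℕ → Set
  LeafAt x p = subtree T p ≡ just (leaf x)

  Phylogenetic : Set
  Phylogenetic = ∀ p ts → subtree T p ≡ just (node ts) → 2 ≤ length ts

  Binary : Set
  Binary = ∀ p ts → subtree T p ≡ just (node ts) → length ts ≡ 2

  LeafSetIsV : Set
  LeafSetIsV = ∀ x → (∃[ p ] LeafAt x p) × (∀ p q → LeafAt x p → LeafAt x q → p ≡ q)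

  _≼_ : List ℕ → List ℕ → Set
  u ≼ v = ∃[ s ] u ≡ v ++ s

  AboveLeaf : Fin n → List ℕ → Set
  AboveLeaf x v = ∃[ p ] (LeafAt x p × p ≼ v)

  IsLca : Fin n → Fin n → List ℕ → Set
  IsLca x y v = IsVertex v × AboveLeaf x v × AboveLeaf y v ×
    (∀ w → IsVertex w → AboveLeaf x w → AboveLeaf y w → v ≼ w)

  Cluster : List ℕ → Fin n → Set
  Cluster v x = AboveLeaf x v

  ChildOfRoot : List ℕ → Set
  ChildOfRoot v = ∃[ i ] (v ≡ i ∷ [] × IsVertex v)

  BestMatch : {C : Set} → (Fin n → C) → Fin n → Fin n → Set
  BestMatch σ x y = σ x ≢ σ y ×
    (∀ y' → σ y' ≡ σ y → ∀ u u' → IsLca x y u → IsLca x y' u' → u ≼ u')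

-- arcs of the best match graph G(T, σ) are exactly BestMatch T σ.

Arcs : ℕ → Set₁
Arcs n = Fin n → Fin n → Set

BinaryExplainableBMG : ∀ {n} {C : Set} → Arcs n → (Fin n → C) → Set
BinaryExplainableBMG {n} E σ =
  ∃[ T ] (Phylogenetic T × Binary T × LeafSetIsV T ×
          (∀ x y → (E x y → BestMatch T σ x y) × (BestMatch T σ x y → E x y)))

module _ {n : ℕ} {C : Set} (E : Arcs n) (σ : Fin n → C) where

  InR : Fin n → Fin n → Fin n → Set
  InR a b b' = σ a ≢ σ b × σ b ≡ σ b' × E a b × ¬ E a b'

  InF : Fin n → Fin n → Fin n → Set
  InF a b b' = σ a ≢ σ b × σ b ≡ σ b' × b ≢ b' × E a b × E a b'

  -- xy|z ∈ R^B(G, σ)   (bb'|a ∈ R^B whenever ab|b' ∈ F)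
  InRB : Fin n → Fin n → Fin n → Set
  InRB x y z = InR x y z ⊎ InF z x y

  -- edge xy of the Aho graph [R^B(G,σ), V]  (xy|z and yx|z denote the same triple)
  AhoEdge : Fin n → Fin n → Set
  AhoEdge x y = ∃[ z ] (InRB x y z ⊎ InRB y x z)

  AhoConnected : Fin n → Fin n → Set
  AhoConnected = Star AhoEdge

  Component : Fin n → Fin n → Set
  Component x y = AhoConnected x y

  IsBlock : (Fin n → Set) → Set
  IsBlock S = ∃[ x ] (∀ y → (S y → Component x y) × (Component x y → S y))

  AtLeastTwoBlocks : Set
  AtLeastTwoBlocks = ∃[ x ] ∃[ y ] ¬ (∀ z → (Component x z → Component y z) × (Component y z → Component x z))

  InTV : Tree n → Set
  InTV T = Phylogenetic T × LeafSetIsV T ×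
    (∀ v → ChildOfRoot T v → IsBlock (Cluster T v)) ×
    (∀ x → ∃[ v ] (ChildOfRoot T v × (∀ y → (Cluster T v y → Component x y) × (Component x y → Cluster T v y))))

  InU-T : Tree n → Fin n → Fin n → Set
  InU-T T x y = (E x y × ¬ BestMatch T σ x y) ⊎ (¬ E x y × BestMatch T σ x y)

  InU-V : Fin n → Fin n → Set
  InU-V x y = ∀ T → InTV T → InU-T T x y

  CostZero : Set
  CostZero = ∀ x y → ¬ InU-V x y

-- Let T be a binary tree explaining (G, σ), with root children t₀ and t₁. Both "grouped"
-- leaves of a triple of R^B lie on the same side of the root: for ab|b' ∈ R because otherwise
-- b' would be a best match of a as well, and for bb'|a (from ab|b' ∈ F) because otherwise one
-- of b, b' would be strictly closer to a than the other. Hence every Aho component lies below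
-- t₀ or below t₁, and there are at least two of them.
--
-- For c(G, 𝒱) = 0 it suffices to find, for each pair (x, y), one tree of 𝒯(𝒱) that gets the
-- arc (x, y) right. Its root has one child per component; the components other than that of
-- x are stars, and in the component of x the leaf x is grouped with exactly its out-neighbours
-- of colour σ(y). If (x, y) is an arc, y is then a best match of x. If not, the best match m
-- of x of colour σ(y) in T yields the triple xm|y, so m is one of those out-neighbours and is
-- strictly closer to x than y.

module Submission where

open import Defs hiding (_≼_)
open import Data.Nat using (ℕ; zero; suc; _≤_; z≤n; s≤s)
open import Data.Nat.Properties using (≤-refl; ≤-antisym)
import Data.Nat as ℕ
open import Data.Fin using (Fin; toℕ; zero; suc)
import Data.Fin as Fin
open import Data.Fin.Properties using (toℕ-injective; all?; 0≢1+n)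
open import Data.List using (List; []; _∷_; _++_; length; map; filter; allFin)
open import Data.List.Properties
  using (++-assoc; ++-identityʳ; ++-identityʳ-unique; ++-conicalˡ; ++-conicalʳ; ∷-injective; ∷-injectiveˡ)
open import Data.List.Membership.Propositional using (_∈_; find; lose)
open import Data.List.Membership.Propositional.Properties using (∈-filter⁺; ∈-filter⁻; ∈-allFin; ∈-map⁺)
open import Data.List.Relation.Unary.Any as Any using (Any; here; there)
import Data.List.Relation.Unary.Any.Properties as Any
open import Data.List.Relation.Unary.All as All using (All; []; _∷_)
import Data.List.Relation.Unary.All.Properties as All
open import Data.List.Relation.Unary.AllPairs as AllPairs using (AllPairs; []; _∷_)
import Data.List.Relation.Unary.AllPairs.Properties as AllPairs
open import Data.List.Relation.Unary.Unique.Propositional using (Unique)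
import Data.List.Relation.Unary.Unique.Propositional.Properties as Unique
open import Data.List.Extrema.Nat using (argmax; argmin; argmax-all; argmin-all; f[xs]≤f[argmax]; f[argmin]≤v⁺)
open import Data.Maybe using (just)
open import Data.Product using (∃-syntax; ∃₂; _×_; _,_; proj₁; proj₂)
import Data.Product as Product
open import Data.Sum using (_⊎_; inj₁; inj₂)
import Data.Sum as Sum
open import Data.Empty using (⊥; ⊥-elim)
open import Function using (_∘_)
open import Relation.Nullary using (¬_; Dec; yes; no)
open import Relation.Nullary.Decidable using (_×-dec_; _→-dec_; ¬?; ¬¬-excluded-middle)
open import Relation.Binary.PropositionalEquality
  using (_≡_; _≢_; refl; sym; trans; cong; cong₂; subst; subst₂; module ≡-Reasoning)
open import Relation.Binary.Construct.Closure.ReflexiveTransitive using (ε; _◅_; _◅◅_; reverse; fold)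

infix 4 _≼_

-- Defs' ancestor order _≼_ T does not depend on T; this is the same relation without the tree.
_≼_ : List ℕ → List ℕ → Set
u ≼ v = ∃[ s ] u ≡ v ++ s

≼-refl : ∀ {u} → u ≼ u
≼-refl {u} = [] , sym (++-identityʳ u)

≼-trans : ∀ {u v w} → u ≼ v → v ≼ w → u ≼ w
≼-trans {w = w} (r , refl) (s , refl) = s ++ r , ++-assoc w s r

≼-antisym : ∀ {u v} → u ≼ v → v ≼ u → u ≡ v
≼-antisym {u} {v} (r , u≡v++r) (r' , v≡u++r') = trans u≡v++r (trans (cong (v ++_) r≡[]) (++-identityʳ v))
  where
  r≡[] : r ≡ []
  r≡[] = ++-conicalʳ r' r (++-identityʳ-unique u
           (trans u≡v++r (trans (cong (_++ r) v≡u++r') (++-assoc u r' r))))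

[]≼⇒≡[] : ∀ {u} → [] ≼ u → u ≡ []
[]≼⇒≡[] {u} (s , e) = ++-conicalˡ u s (sym e)

≼-length⇒≡ : ∀ {u v} → u ≼ v → length u ≤ length v → u ≡ v
≼-length⇒≡ {v = v} (r , refl) le = trans (cong (v ++_) (r≡[] v le)) (++-identityʳ v)
  where
  r≡[] : ∀ v {r} → length (v ++ r) ≤ length v → r ≡ []
  r≡[] []      {[]} _       = refl
  r≡[] (_ ∷ v)      (s≤s le) = r≡[] v le

ancestors-comparable : ∀ u v {p} → p ≼ u → p ≼ v → u ≼ v ⊎ v ≼ u
ancestors-comparable []      v       _        _        = inj₂ (v , refl)
ancestors-comparable (a ∷ u) []      _        _        = inj₁ (a ∷ u , refl)
ancestors-comparable (a ∷ u) (b ∷ v) (s , refl) (s' , e) with ∷-injective e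
... | refl , e' = Sum.map (Product.map₂ (cong (a ∷_))) (Product.map₂ (cong (a ∷_)))
                    (ancestors-comparable u v (s , refl) (s' , e'))

lcp : List ℕ → List ℕ → List ℕ
lcp (a ∷ p) (b ∷ q) with a ℕ.≟ b
... | yes _ = a ∷ lcp p q
... | no  _ = []
lcp _ _ = []

lcp-∷ : ∀ a p q → lcp (a ∷ p) (a ∷ q) ≡ a ∷ lcp p q
lcp-∷ a p q with a ℕ.≟ a
... | yes _   = refl
... | no  a≢a = ⊥-elim (a≢a refl)

lcp-∷-≢ : ∀ {a b} p q → a ≢ b → lcp (a ∷ p) (b ∷ q) ≡ []
lcp-∷-≢ {a} {b} p q a≢b with a ℕ.≟ b
... | yes a≡b = ⊥-elim (a≢b a≡b)
... | no  _   = refl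

lcp-++ : ∀ u p q → lcp (u ++ p) (u ++ q) ≡ u ++ lcp p q
lcp-++ []      p q = refl
lcp-++ (a ∷ u) p q = trans (lcp-∷ a (u ++ p) (u ++ q)) (cong (a ∷_) (lcp-++ u p q))

≼-lcpˡ : ∀ p q → p ≼ lcp p q
≼-lcpˡ (a ∷ p) (b ∷ q) with a ℕ.≟ b
... | yes _ = Product.map₂ (cong (a ∷_)) (≼-lcpˡ p q)
... | no  _ = a ∷ p , refl
≼-lcpˡ []      _       = [] , refl
≼-lcpˡ (a ∷ p) []      = a ∷ p , refl

≼-lcpʳ : ∀ p q → q ≼ lcp p q
≼-lcpʳ (a ∷ p) (b ∷ q) with a ℕ.≟ b
... | yes refl = Product.map₂ (cong (a ∷_)) (≼-lcpʳ p q)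
... | no  _    = b ∷ q , refl
≼-lcpʳ []      q       = q , refl
≼-lcpʳ (a ∷ p) []      = [] , refl

lcp-greatest : ∀ w {p q} → p ≼ w → q ≼ w → lcp p q ≼ w
lcp-greatest []      {p} {q} _ _ = lcp p q , refl
lcp-greatest (a ∷ w) (s , refl) (s' , refl) rewrite lcp-∷ a (w ++ s) (w ++ s') =
  Product.map₂ (cong (a ∷_)) (lcp-greatest w (s , refl) (s' , refl))

module _ {n : ℕ} where

  _∈ᵗ_ : Fin n → Tree n → Set
  z ∈ᵗ t = ∃[ p ] LeafAt t z p

  mutual
    subtree-++ : ∀ (t : Tree n) p q {s} → subtree t p ≡ just s → subtree t (p ++ q) ≡ subtree s q
    subtree-++ t         []      q refl = refl
    subtree-++ (node ts) (i ∷ p) q e    = subtreeL-++ ts i p q e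

    subtreeL-++ : ∀ (ts : List (Tree n)) i p q {s} → subtreeL ts i p ≡ just s → subtreeL ts i (p ++ q) ≡ subtree s q
    subtreeL-++ (t ∷ ts) zero    p q e = subtree-++ t p q e
    subtreeL-++ (t ∷ ts) (suc i) p q e = subtreeL-++ ts i p q e

  mutual
    subtree-++⁻ : ∀ (t : Tree n) p q {r} → subtree t (p ++ q) ≡ just r →
                  ∃[ s ] (subtree t p ≡ just s × subtree s q ≡ just r)
    subtree-++⁻ t         []      q e = t , refl , e
    subtree-++⁻ (node ts) (i ∷ p) q e = subtreeL-++⁻ ts i p q e

    subtreeL-++⁻ : ∀ (ts : List (Tree n)) i p q {r} → subtreeL ts i (p ++ q) ≡ just r →
                   ∃[ s ] (subtreeL ts i p ≡ just s × subtree s q ≡ just r)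
    subtreeL-++⁻ (t ∷ ts) zero    p q e = subtree-++⁻ t p q e
    subtreeL-++⁻ (t ∷ ts) (suc i) p q e = subtreeL-++⁻ ts i p q e

  subtreeL⁻ : ∀ (ts : List (Tree n)) i p {s} → subtreeL ts i p ≡ just s → Any (λ t → subtree t p ≡ just s) ts
  subtreeL⁻ (t ∷ ts) zero    p e = here e
  subtreeL⁻ (t ∷ ts) (suc i) p e = there (subtreeL⁻ ts i p e)

  subtreeL-map⁻ : ∀ {A : Set} (f : A → Tree n) l j p {s} → subtreeL (map f l) j p ≡ just s →
                  ∃[ r ] (r ∈ l × subtree (f r) p ≡ just s)
  subtreeL-map⁻ f l j p {s} e = find (Any.map⁻ {P = λ t → subtree t p ≡ just s} (subtreeL⁻ (map f l) j p e))

  subtreeL-map⁺ : ∀ {A : Set} (f : A → Tree n) {r l} → r ∈ l →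
                  ∃[ j ] ∀ p → subtreeL (map f l) j p ≡ subtree (f r) p
  subtreeL-map⁺ f (here refl) = zero , λ _ → refl
  subtreeL-map⁺ f (there r∈)  = let (j , j↦) = subtreeL-map⁺ f r∈ in suc j , j↦

  ∈ᵗ-leaf : ∀ {z a} → z ∈ᵗ leaf a → z ≡ a
  ∈ᵗ-leaf ([] , refl) = refl

  subtreeL⇒∈ᵗ : ∀ {z} (ts : List (Tree n)) i p → subtreeL ts i p ≡ just (leaf z) → Any (z ∈ᵗ_) ts
  subtreeL⇒∈ᵗ ts i p e = Any.map (p ,_) (subtreeL⁻ ts i p e)

  ∈ᵗ-node⁻ : ∀ {z} ts → z ∈ᵗ node ts → Any (z ∈ᵗ_) ts
  ∈ᵗ-node⁻ ts (i ∷ p , e) = subtreeL⇒∈ᵗ ts i p e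

  ∈ᵗ-node⁺ : ∀ {z ts} → Any (z ∈ᵗ_) ts → z ∈ᵗ node ts
  ∈ᵗ-node⁺ (here (p , e)) = zero ∷ p , e
  ∈ᵗ-node⁺ (there z∈)     with ∈ᵗ-node⁺ z∈
  ... | i ∷ p , e = suc i ∷ p , e

  ∈ᵗ-leaves⁻ : ∀ {z l} → Any (z ∈ᵗ_) (map leaf l) → z ∈ l
  ∈ᵗ-leaves⁻ z∈ = Any.map ∈ᵗ-leaf (Any.map⁻ z∈)

  ∈ᵗ-leaves⁺ : ∀ {z l} → z ∈ l → Any (z ∈ᵗ_) (map leaf l)
  ∈ᵗ-leaves⁺ z∈ = Any.map⁺ (Any.map (λ { refl → [] , refl }) z∈)

  -- A node with a single child would not be phylogenetic, so it is replaced by that child.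
  join : List (Tree n) → Tree n
  join (t ∷ []) = t
  join ts       = node ts

  ∈ᵗ-join⁻ : ∀ {z} ts → z ∈ᵗ join ts → Any (z ∈ᵗ_) ts
  ∈ᵗ-join⁻ []           z∈ = ∈ᵗ-node⁻ [] z∈
  ∈ᵗ-join⁻ (t ∷ [])     z∈ = here z∈
  ∈ᵗ-join⁻ (t ∷ u ∷ ts) z∈ = ∈ᵗ-node⁻ (t ∷ u ∷ ts) z∈

  ∈ᵗ-join⁺ : ∀ {z} ts → Any (z ∈ᵗ_) ts → z ∈ᵗ join ts
  ∈ᵗ-join⁺ []           z∈         = ∈ᵗ-node⁺ z∈
  ∈ᵗ-join⁺ (t ∷ [])     (here z∈) = z∈
  ∈ᵗ-join⁺ (t ∷ u ∷ ts) z∈         = ∈ᵗ-node⁺ z∈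

  join-head : ∀ t ts → ∃[ Q ] subtree (join (t ∷ ts)) Q ≡ just t
  join-head t []      = [] , refl
  join-head t (_ ∷ _) = zero ∷ [] , refl

  join-node : ∀ t {u ts} → u ∈ ts → join (t ∷ ts) ≡ node (t ∷ ts)
  join-node t (here _)  = refl
  join-node t (there _) = refl

  cluster-∈ᵗ : ∀ T v {S y} → subtree T v ≡ just S → (Cluster T v y → y ∈ᵗ S) × (y ∈ᵗ S → Cluster T v y)
  cluster-∈ᵗ T v v↦S =
    (λ { (p , e , s , refl) → s , trans (sym (subtree-++ T v s v↦S)) e }) ,
    (λ { (s , e) → v ++ s , trans (subtree-++ T v s v↦S) e , s , refl })

  UniqueLeaves : Tree n → Set
  UniqueLeaves t = ∀ z p q → LeafAt t z p → LeafAt t z q → p ≡ q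

  DisjointLeaves : Tree n → Tree n → Set
  DisjointLeaves t u = ∀ z → z ∈ᵗ t → z ∈ᵗ u → ⊥

  uniqueLeaves-leaf : ∀ a → UniqueLeaves (leaf a)
  uniqueLeaves-leaf a z [] [] _ _ = refl

  uniqueLeaves-node : ∀ {ts} → All UniqueLeaves ts → AllPairs DisjointLeaves ts → UniqueLeaves (node ts)
  uniqueLeaves-node us ds z (i ∷ p) (j ∷ q) = unique-in us ds i j p q
    where
    unique-in : ∀ {ts} → All UniqueLeaves ts → AllPairs DisjointLeaves ts → ∀ i j p q →
                subtreeL ts i p ≡ just (leaf z) → subtreeL ts j q ≡ just (leaf z) → i ∷ p ≡ j ∷ q
    unique-in (u ∷ _) _ zero zero p q e e' = cong (zero ∷_) (u z p q e e')
    unique-in {t ∷ ts} _ (d ∷ _) zero (suc j) p q e e' =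
      ⊥-elim (let (d' , z∈) = All.lookupAny d (subtreeL⇒∈ᵗ ts j q e') in d' z (p , e) z∈)
    unique-in {t ∷ ts} _ (d ∷ _) (suc i) zero p q e e' =
      ⊥-elim (let (d' , z∈) = All.lookupAny d (subtreeL⇒∈ᵗ ts i p e) in d' z (q , e') z∈)
    unique-in (_ ∷ us) (_ ∷ ds) (suc i) (suc j) p q e e' =
      let (i≡j , p≡q) = ∷-injective (unique-in us ds i j p q e e') in cong₂ _∷_ (cong suc i≡j) p≡q

  uniqueLeaves-join : ∀ {ts} → All UniqueLeaves ts → AllPairs DisjointLeaves ts → UniqueLeaves (join ts)
  uniqueLeaves-join {[]}         us       ds = uniqueLeaves-node us ds
  uniqueLeaves-join {t ∷ []}     (u ∷ []) _  = u
  uniqueLeaves-join {t ∷ _ ∷ _}  us       ds = uniqueLeaves-node us ds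

  uniqueLeaves-leaves : ∀ l → All UniqueLeaves (map leaf l)
  uniqueLeaves-leaves l = All.map⁺ (All.universal uniqueLeaves-leaf l)

  disjointLeaves-leaves : ∀ {l} → Unique l → AllPairs DisjointLeaves (map leaf l)
  disjointLeaves-leaves u = AllPairs.map⁺ (AllPairs.map distinct u)
    where
    distinct : ∀ {a b} → a ≢ b → DisjointLeaves (leaf a) (leaf b)
    distinct a≢b _ z∈a z∈b = a≢b (trans (sym (∈ᵗ-leaf z∈a)) (∈ᵗ-leaf z∈b))

  uniqueLeaves-join-leaves : ∀ {t l} → UniqueLeaves t → Unique l → All (λ b → ¬ b ∈ᵗ t) l →
                             UniqueLeaves (join (t ∷ map leaf l))
  uniqueLeaves-join-leaves {t} {l} ut ul l∉t =
    uniqueLeaves-join (ut ∷ uniqueLeaves-leaves l) (All.map⁺ (All.map apart l∉t) ∷ disjointLeaves-leaves ul)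
    where
    apart : ∀ {b} → ¬ b ∈ᵗ t → DisjointLeaves t (leaf b)
    apart b∉t _ z∈t z∈b = b∉t (subst (_∈ᵗ t) (∈ᵗ-leaf z∈b) z∈t)

  phylogenetic-leaf : ∀ (a : Fin n) → Phylogenetic (leaf a)
  phylogenetic-leaf a [] _ ()

  phylogenetic-node : ∀ {t u : Tree n} {ts} → u ∈ ts → All Phylogenetic (t ∷ ts) → Phylogenetic (node (t ∷ ts))
  phylogenetic-node (here refl) _ [] _ refl = s≤s (s≤s z≤n)
  phylogenetic-node (there _)   _ [] _ refl = s≤s (s≤s z≤n)
  phylogenetic-node {t} {ts = ts} _ ps (i ∷ p) us e = in-child ps (subtreeL⁻ (t ∷ ts) i p e)
    where
    in-child : ∀ {ts'} → All Phylogenetic ts' → Any (λ t' → subtree t' p ≡ just (node us)) ts' → 2 ≤ length us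
    in-child (ph ∷ _)  (here e') = ph p us e'
    in-child (_ ∷ ps') (there a) = in-child ps' a

  phylogenetic-join : ∀ {t ts} → All Phylogenetic (t ∷ ts) → Phylogenetic (join (t ∷ ts))
  phylogenetic-join {ts = []}    (p ∷ []) = p
  phylogenetic-join {ts = _ ∷ _} ps       = phylogenetic-node (here refl) ps

  phylogenetic-join-leaves : ∀ {a l} → a ∈ l → Phylogenetic (join (map leaf l))
  phylogenetic-join-leaves {l = b ∷ l} _ = phylogenetic-join (All.map⁺ (All.universal phylogenetic-leaf (b ∷ l)))

  phylogenetic-subtree : ∀ {T p s} → Phylogenetic T → subtree T p ≡ just s → Phylogenetic s
  phylogenetic-subtree {T} {p} ph p↦s q us e = ph (p ++ q) us (trans (subtree-++ T p q p↦s) e)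

  phylogenetic-hasLeaf : ∀ t → Phylogenetic t → ∃[ z ] z ∈ᵗ t
  phylogenetic-hasLeaf (leaf z)         _  = z , [] , refl
  phylogenetic-hasLeaf (node [])        ph with ph [] [] refl
  ... | ()
  phylogenetic-hasLeaf (node (t ∷ ts)) ph =
    let (z , p , e) = phylogenetic-hasLeaf t (phylogenetic-subtree {p = zero ∷ []} ph refl) in z , zero ∷ p , e

module _ {n : ℕ} {P : Fin n → Set} (P? : ∀ b → Dec (P b)) where

  ∈-filterFin⁺ : ∀ {b} → P b → b ∈ filter P? (allFin n)
  ∈-filterFin⁺ = ∈-filter⁺ P? (∈-allFin _)

  ∈-filterFin⁻ : ∀ {b} → b ∈ filter P? (allFin n) → P b
  ∈-filterFin⁻ = proj₂ ∘ ∈-filter⁻ P? {xs = allFin n}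

Explains : ∀ {n} {C : Set} → Tree n → Arcs n → (Fin n → C) → Set
Explains T E σ = ∀ x y → (E x y → BestMatch T σ x y) × (BestMatch T σ x y → E x y)

explains⇒properlyColoured : ∀ {n C T E} {σ : Fin n → C} → Explains T E σ → ∀ {x y} → E x y → σ x ≢ σ y
explains⇒properlyColoured explains {x} {y} Exy = proj₁ (proj₁ (explains x y) Exy)

module LeafAddresses {n : ℕ} (T : Tree n) (leafSet : LeafSetIsV T) where

  addr : Fin n → List ℕ
  addr x = proj₁ (proj₁ (leafSet x))

  addr-leafAt : ∀ x → LeafAt T x (addr x)
  addr-leafAt x = proj₂ (proj₁ (leafSet x))

  leafAt⇒addr : ∀ {x p} → LeafAt T x p → p ≡ addr x
  leafAt⇒addr {x} {p} l = proj₂ (leafSet x) p (addr x) l (addr-leafAt x)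

  aboveLeaf⇒≼ : ∀ {x w} → AboveLeaf T x w → addr x ≼ w
  aboveLeaf⇒≼ (p , l , s , p≡w++s) = s , trans (sym (leafAt⇒addr l)) p≡w++s

  lca : Fin n → Fin n → List ℕ
  lca x y = lcp (addr x) (addr y)

  lca-isLca : ∀ x y → IsLca T x y (lca x y)
  lca-isLca x y = vertex , (addr x , addr-leafAt x , ≼-lcpˡ (addr x) (addr y)) ,
                           (addr y , addr-leafAt y , ≼-lcpʳ (addr x) (addr y)) ,
                           λ w _ x≼w y≼w → lcp-greatest w (aboveLeaf⇒≼ x≼w) (aboveLeaf⇒≼ y≼w)
    where
    vertex : IsVertex T (lca x y)
    vertex = let (s , addr≡) = ≼-lcpˡ (addr x) (addr y)
                 (r , lca↦r , _) = subtree-++⁻ T (lca x y) s (subst (λ p → LeafAt T x p) addr≡ (addr-leafAt x))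
             in r , lca↦r

  isLca⇒≡lca : ∀ {x y v} → IsLca T x y v → v ≡ lca x y
  isLca⇒≡lca {x} {y} {v} (_ , x≼v , y≼v , lowest) =
    let (vertex , x≼lca , y≼lca , _) = lca-isLca x y
    in ≼-antisym (lowest (lca x y) vertex x≼lca y≼lca) (lcp-greatest v (aboveLeaf⇒≼ x≼v) (aboveLeaf⇒≼ y≼v))

  module _ {C : Set} (σ : Fin n → C) where

    bestMatch⇒lca≼ : ∀ {x y y'} → BestMatch T σ x y → σ y' ≡ σ y → lca x y ≼ lca x y'
    bestMatch⇒lca≼ {x} {y} {y'} (_ , deepest) e = deepest y' e (lca x y) (lca x y') (lca-isLca x y) (lca-isLca x y')

    lca≼⇒bestMatch : ∀ {x y} → σ x ≢ σ y → (∀ y' → σ y' ≡ σ y → lca x y ≼ lca x y') → BestMatch T σ x y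
    lca≼⇒bestMatch σx≢σy deepest =
      σx≢σy , λ y' e u u' u-lca u'-lca → subst₂ _≼_ (sym (isLca⇒≡lca u-lca)) (sym (isLca⇒≡lca u'-lca)) (deepest y' e)

    -- A best match of colour c is a c-coloured leaf whose lca with x is deepest.
    bestMatch-exists : ∀ {c} → (∀ b → Dec (σ b ≡ c)) → ∀ x y → σ x ≢ c → σ y ≡ c →
                       ∃[ m ] (σ m ≡ c × BestMatch T σ x m)
    bestMatch-exists {c} σ? x y σx≢c σy≡c = m , σm≡c , lca≼⇒bestMatch (λ e → σx≢c (trans e σm≡c)) deepest
      where
      depth : Fin n → ℕ
      depth = length ∘ lca x

      candidates : List (Fin n)
      candidates = filter σ? (allFin n)

      m : Fin n
      m = argmax depth y candidates

      σm≡c : σ m ≡ c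
      σm≡c = argmax-all depth σy≡c (All.all-filter σ? (allFin n))

      deepest : ∀ y' → σ y' ≡ σ m → lca x m ≼ lca x y'
      deepest y' e with ancestors-comparable (lca x m) (lca x y') (≼-lcpˡ (addr x) (addr m)) (≼-lcpˡ (addr x) (addr y'))
      ... | inj₁ m-below = m-below
      ... | inj₂ y'-below = subst (lca x m ≼_) (sym (≼-length⇒≡ y'-below y'-shallower)) ≼-refl
        where
        y'-shallower : depth y' ≤ depth m
        y'-shallower = All.lookup (f[xs]≤f[argmax] y candidates) (∈-filterFin⁺ σ? (trans e σm≡c))

module _ {n : ℕ} where

  infix 4 _≐_
  _≐_ : (Fin n → Set) → (Fin n → Set) → Set
  P ≐ Q = ∀ y → (P y → Q y) × (Q y → P y)

  ≐-trans : ∀ {P Q R} → P ≐ Q → Q ≐ R → P ≐ R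
  ≐-trans P≐Q Q≐R y = proj₁ (Q≐R y) ∘ proj₁ (P≐Q y) , proj₂ (P≐Q y) ∘ proj₂ (Q≐R y)

module _ {n : ℕ} {C : Set} (E : Arcs n) (σ : Fin n → C) where

  AhoEdge-sym : ∀ {a b} → AhoEdge E σ a b → AhoEdge E σ b a
  AhoEdge-sym (z , inj₁ t) = z , inj₂ t
  AhoEdge-sym (z , inj₂ t) = z , inj₁ t

  Component-sym : ∀ {a b} → Component E σ a b → Component E σ b a
  Component-sym = reverse AhoEdge-sym

  Component-≐ : ∀ {a b} → Component E σ a b → Component E σ a ≐ Component E σ b
  Component-≐ a~b y = (Component-sym a~b ◅◅_) , (a~b ◅◅_)

  separated⇒atLeastTwoBlocks : ∀ {z₀ z₁} → ¬ Component E σ z₀ z₁ → AtLeastTwoBlocks E σ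
  separated⇒atLeastTwoBlocks {z₀} {z₁} z₀≁z₁ = z₀ , z₁ , λ same → z₀≁z₁ (proj₂ (same z₁) ε)

  -- If E x y' fails, xy|y' ∈ R joins x to y; otherwise xy|y' ∈ F puts yy'|x into R^B, joining y to y'.
  sameColour-outside : ∀ {x y y'} → E x y → σ x ≢ σ y → σ y' ≡ σ y →
                     ¬ Component E σ x y → ¬ Component E σ x y'
  sameColour-outside {x} {y} {y'} Exy σx≢σy σy'≡σy x≁y x~y' with y Fin.≟ y'
  ... | yes refl = x≁y x~y'
  ... | no  y≢y' = ¬¬-excluded-middle λ where
    (yes Exy') → x≁y (x~y' ◅◅ AhoEdge-sym (x , inj₁ (inj₂ (σx≢σy , sym σy'≡σy , y≢y' , Exy , Exy'))) ◅ ε)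
    (no ¬Exy') → x≁y ((y' , inj₁ (inj₁ (σx≢σy , sym σy'≡σy , Exy , ¬Exy'))) ◅ ε)

  module Representatives (K? : ∀ a b → Dec (Component E σ a b)) where

    members : Fin n → List (Fin n)
    members r = filter (K? r) (allFin n)

    ∈-members : ∀ {r z} → z ∈ members r → Component E σ r z
    ∈-members = ∈-filterFin⁻ (K? _)

    members-∈ : ∀ {r z} → Component E σ r z → z ∈ members r
    members-∈ = ∈-filterFin⁺ (K? _)

    Canonical : Fin n → Set
    Canonical r = ∀ w → Component E σ w r → toℕ r ≤ toℕ w

    canonical? : ∀ r → Dec (Canonical r)
    canonical? r = all? (λ w → K? w r →-dec (toℕ r ℕ.≤? toℕ w))

    canonical-unique : ∀ {r r'} → Canonical r → Canonical r' → Component E σ r r' → r ≡ r'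
    canonical-unique {r} {r'} cr cr' r~r' = toℕ-injective (≤-antisym (cr r' (Component-sym r~r')) (cr' r r~r'))

    rep : Fin n → Fin n
    rep z = argmin toℕ z (members z)

    rep-component : ∀ z → Component E σ z (rep z)
    rep-component z = argmin-all toℕ ε (All.all-filter (K? z) (allFin n))

    rep-canonical : ∀ z → Canonical (rep z)
    rep-canonical z w w~rep = f[argmin]≤v⁺ z (members z) (inj₂ (Any.map (λ { refl → ≤-refl }) (members-∈ z~w)))
      where
      z~w : Component E σ z w
      z~w = rep-component z ◅◅ Component-sym w~rep

other-of-two : ∀ {a b c : Fin 2} → a ≢ b → a ≢ c → b ≡ c
other-of-two {zero}     {suc zero} {suc zero} _   _   = refl
other-of-two {suc zero} {zero}     {zero}     _   _   = refl
other-of-two {zero}     {zero}                a≢b _   = ⊥-elim (a≢b refl)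
other-of-two {suc zero} {suc zero}            a≢b _   = ⊥-elim (a≢b refl)
other-of-two {zero}     {suc zero} {zero}     _   a≢c = ⊥-elim (a≢c refl)
other-of-two {suc zero} {zero}     {suc zero} _   a≢c = ⊥-elim (a≢c refl)

module BinaryRoot {n : ℕ} {C : Set} (E : Arcs n) (σ : Fin n → C) (t₀ t₁ : Tree n)
  (phylogenetic : Phylogenetic (node (t₀ ∷ t₁ ∷ [])))
  (leafSet : LeafSetIsV (node (t₀ ∷ t₁ ∷ [])))
  (explains : Explains (node (t₀ ∷ t₁ ∷ [])) E σ) where

  T : Tree n
  T = node (t₀ ∷ t₁ ∷ [])

  open LeafAddresses T leafSet

  side-split : ∀ x → ∃₂ λ (s : Fin 2) q → addr x ≡ toℕ s ∷ q
  side-split x with addr x | addr-leafAt x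
  ... | zero ∷ q          | _ = zero , q , refl
  ... | suc zero ∷ q      | _ = suc zero , q , refl
  ... | suc (suc _) ∷ _   | ()

  side : Fin n → Fin 2
  side x = proj₁ (side-split x)

  rest : Fin n → List ℕ
  rest x = proj₁ (proj₂ (side-split x))

  addr-side : ∀ x → addr x ≡ toℕ (side x) ∷ rest x
  addr-side x = proj₂ (proj₂ (side-split x))

  lca-otherSide : ∀ {x y} → side x ≢ side y → lca x y ≡ []
  lca-otherSide {x} {y} x≢y = trans (cong₂ lcp (addr-side x) (addr-side y)) (lcp-∷-≢ _ _ (x≢y ∘ toℕ-injective))

  lca-sameSide : ∀ {x y} → side x ≡ side y → lca x y ≢ []
  lca-sameSide {x} {y} x≡y = subst (_≢ []) (sym lca≡∷) λ ()
    where
    lca≡∷ : lca x y ≡ toℕ (side x) ∷ lcp (rest x) (rest y)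
    lca≡∷ = trans (cong₂ lcp (addr-side x) (trans (addr-side y) (cong (λ s → toℕ s ∷ rest y) (sym x≡y))))
                  (lcp-∷ (toℕ (side x)) (rest x) (rest y))

  sameSide-bestMatch : ∀ {z x y} → BestMatch T σ z y → σ x ≡ σ y → side z ≡ side x → side z ≡ side y
  sameSide-bestMatch {z} {x} {y} z→y σx≡σy z≡x with side z Fin.≟ side y
  ... | yes z≡y = z≡y
  ... | no  z≢y =
    ⊥-elim (lca-sameSide z≡x ([]≼⇒≡[] (subst (_≼ lca z x) (lca-otherSide z≢y) (bestMatch⇒lca≼ σ z→y σx≡σy))))

  informative-sameSide : ∀ {a b b'} → InR E σ a b b' → side a ≡ side b
  informative-sameSide {a} {b} {b'} (σa≢σb , σb≡σb' , Eab , ¬Eab') with side a Fin.≟ side b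
  ... | yes a≡b = a≡b
  ... | no  a≢b = ⊥-elim (¬Eab' (proj₂ (explains a b') a→b'))
    where
    lca≡[] : ∀ y' → σ y' ≡ σ b → lca a y' ≡ []
    lca≡[] y' e = []≼⇒≡[] (subst (_≼ lca a y') (lca-otherSide a≢b) (bestMatch⇒lca≼ σ (proj₁ (explains a b) Eab) e))

    a→b' : BestMatch T σ a b'
    a→b' = lca≼⇒bestMatch σ (λ e → σa≢σb (trans e (sym σb≡σb'))) λ y' e →
      subst₂ _≼_ (sym (lca≡[] b' (sym σb≡σb'))) (sym (lca≡[] y' (trans e (sym σb≡σb')))) ≼-refl

  forbidden-sameSide : ∀ {z x y} → InF E σ z x y → side x ≡ side y
  forbidden-sameSide {z} {x} {y} (_ , σx≡σy , _ , Ezx , Ezy) with side z Fin.≟ side x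
  ... | yes z≡x = trans (sym z≡x) (sameSide-bestMatch (proj₁ (explains z y) Ezy) σx≡σy z≡x)
  ... | no  z≢x = other-of-two z≢x (z≢x ∘ sameSide-bestMatch (proj₁ (explains z x) Ezx) (sym σx≡σy))

  component-sameSide : ∀ {x y} → Component E σ x y → side x ≡ side y
  component-sameSide = fold (λ x y → side x ≡ side y) (λ e eq → trans (edge-sameSide e) eq) refl
    where
    triple-sameSide : ∀ {x y z} → InRB E σ x y z → side x ≡ side y
    triple-sameSide (inj₁ r) = informative-sameSide r
    triple-sameSide (inj₂ f) = forbidden-sameSide f

    edge-sameSide : ∀ {x y} → AhoEdge E σ x y → side x ≡ side y
    edge-sameSide (_ , inj₁ t) = triple-sameSide t
    edge-sameSide (_ , inj₂ t) = sym (triple-sameSide t)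

  leafOnSide : ∀ s → ∃[ z ] side z ≡ s
  leafOnSide s =
    let (t , s↦t) = child s
        (z , q , z∈t) = phylogenetic-hasLeaf t (phylogenetic-subtree {p = toℕ s ∷ []} phylogenetic s↦t)
        addr≡ = leafAt⇒addr (trans (subtree-++ T (toℕ s ∷ []) q s↦t) z∈t)
    in z , toℕ-injective (∷-injectiveˡ (trans (sym (addr-side z)) (sym addr≡)))
    where
    child : ∀ s → ∃[ t ] subtree T (toℕ s ∷ []) ≡ just t
    child zero       = t₀ , refl
    child (suc zero) = t₁ , refl

  separated : ∃₂ λ z₀ z₁ → ¬ Component E σ z₀ z₁
  separated =
    let (z₀ , z₀-left) = leafOnSide zero
        (z₁ , z₁-right) = leafOnSide (suc zero)
    in z₀ , z₁ , λ z₀~z₁ → 0≢1+n (trans (sym z₀-left) (trans (component-sameSide z₀~z₁) z₁-right))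

module Witness {n : ℕ} {C : Set} (E : Arcs n) (σ : Fin n → C) (T : Tree n)
  (leafSet : LeafSetIsV T) (explains : Explains T E σ)
  (z₀ z₁ : Fin n) (z₀≁z₁ : ¬ Component E σ z₀ z₁) (x y₀ : Fin n)
  (K? : ∀ a b → Dec (Component E σ a b)) (σ? : ∀ b → Dec (σ b ≡ σ y₀)) (E? : ∀ b → Dec (E x b)) where

  open Representatives E σ K?

  Target : Fin n → Set
  Target b = Component E σ x b × σ b ≡ σ y₀ × E x b

  Other : Fin n → Set
  Other b = Component E σ x b × b ≢ x × ¬ Target b

  Foreign : Fin n → Set
  Foreign r = ¬ Component E σ x r × Canonical r

  target? : ∀ b → Dec (Target b)
  target? b = K? x b ×-dec σ? b ×-dec E? b

  other? : ∀ b → Dec (Other b)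
  other? b = K? x b ×-dec ¬? (b Fin.≟ x) ×-dec ¬? (target? b)

  foreign? : ∀ r → Dec (Foreign r)
  foreign? r = ¬? (K? x r) ×-dec canonical? r

  targets others foreigns : List (Fin n)
  targets  = filter target? (allFin n)
  others   = filter other? (allFin n)
  foreigns = filter foreign? (allFin n)

  star : Fin n → Tree n
  star r = join (map leaf (members r))

  inner home witness : Tree n
  inner   = join (leaf x ∷ map leaf targets)
  home    = join (inner ∷ map leaf others)
  witness = node (home ∷ map star foreigns)

  x-not-target : ¬ Target x
  x-not-target (_ , _ , Exx) = explains⇒properlyColoured explains Exx refl

  inner-leaves⁻ : ∀ {z} → z ∈ᵗ inner → z ≡ x ⊎ Target z
  inner-leaves⁻ z∈ with ∈ᵗ-join⁻ (leaf x ∷ map leaf targets) z∈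
  ... | here z∈x  = inj₁ (∈ᵗ-leaf z∈x)
  ... | there z∈ = inj₂ (∈-filterFin⁻ target? (∈ᵗ-leaves⁻ z∈))

  inner-leaves⁺ : ∀ {z} → z ≡ x ⊎ Target z → z ∈ᵗ inner
  inner-leaves⁺ (inj₁ refl) = ∈ᵗ-join⁺ (leaf x ∷ map leaf targets) (here ([] , refl))
  inner-leaves⁺ (inj₂ tz)   =
    ∈ᵗ-join⁺ (leaf x ∷ map leaf targets) (there (∈ᵗ-leaves⁺ (∈-filterFin⁺ target? tz)))

  home-≐ : (_∈ᵗ home) ≐ Component E σ x
  home-≐ z = leaves⁻ , leaves⁺
    where
    leaves⁻ : z ∈ᵗ home → Component E σ x z
    leaves⁻ z∈ with ∈ᵗ-join⁻ (inner ∷ map leaf others) z∈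
    ... | there z∈others = proj₁ (∈-filterFin⁻ other? (∈ᵗ-leaves⁻ z∈others))
    ... | here z∈inner with inner-leaves⁻ z∈inner
    ...   | inj₁ refl      = ε
    ...   | inj₂ (x~z , _) = x~z

    leaves⁺ : Component E σ x z → z ∈ᵗ home
    leaves⁺ x~z with z Fin.≟ x | target? z
    ... | yes z≡x | _      = ∈ᵗ-join⁺ (inner ∷ map leaf others) (here (inner-leaves⁺ (inj₁ z≡x)))
    ... | no  _   | yes tz = ∈ᵗ-join⁺ (inner ∷ map leaf others) (here (inner-leaves⁺ (inj₂ tz)))
    ... | no  z≢x | no ¬tz =
      ∈ᵗ-join⁺ (inner ∷ map leaf others) (there (∈ᵗ-leaves⁺ (∈-filterFin⁺ other? (x~z , z≢x , ¬tz))))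

  star-≐ : ∀ r → (_∈ᵗ star r) ≐ Component E σ r
  star-≐ r z = ∈-members ∘ ∈ᵗ-leaves⁻ ∘ ∈ᵗ-join⁻ (map leaf (members r)) ,
               ∈ᵗ-join⁺ (map leaf (members r)) ∘ ∈ᵗ-leaves⁺ ∘ members-∈

  inner-unique : UniqueLeaves inner
  inner-unique = uniqueLeaves-join-leaves (uniqueLeaves-leaf x) (Unique.filter⁺ target? (Unique.allFin⁺ n))
    (All.map (λ tb b∈x → x-not-target (subst Target (∈ᵗ-leaf b∈x) tb)) (All.all-filter target? (allFin n)))

  home-unique : UniqueLeaves home
  home-unique = uniqueLeaves-join-leaves inner-unique (Unique.filter⁺ other? (Unique.allFin⁺ n))
    (All.map (λ { (_ , b≢x , ¬tb) b∈inner → Sum.[ b≢x , ¬tb ] (inner-leaves⁻ b∈inner) })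
             (All.all-filter other? (allFin n)))

  star-unique : ∀ r → UniqueLeaves (star r)
  star-unique r = uniqueLeaves-join (uniqueLeaves-leaves (members r))
    (disjointLeaves-leaves (Unique.filter⁺ (K? r) (Unique.allFin⁺ n)))

  home-apart : All (λ r → DisjointLeaves home (star r)) foreigns
  home-apart = All.map apart (All.all-filter foreign? (allFin n))
    where
    apart : ∀ {r} → Foreign r → DisjointLeaves home (star r)
    apart (x≁r , _) z z∈home z∈r = x≁r (proj₁ (home-≐ z) z∈home ◅◅ Component-sym E σ (proj₁ (star-≐ _ z) z∈r))

  stars-apart : AllPairs (λ r r' → DisjointLeaves (star r) (star r')) foreigns
  stars-apart = apart (All.all-filter foreign? (allFin n)) (Unique.filter⁺ foreign? (Unique.allFin⁺ n))
    where
    distinct-apart : ∀ {r r'} → Foreign r → Foreign r' → r ≢ r' → DisjointLeaves (star r) (star r')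
    distinct-apart (_ , cr) (_ , cr') r≢r' _ z∈r z∈r' =
      r≢r' (canonical-unique cr cr' (proj₁ (star-≐ _ _) z∈r ◅◅ Component-sym E σ (proj₁ (star-≐ _ _) z∈r')))

    apart : ∀ {rs} → All Foreign rs → AllPairs _≢_ rs → AllPairs (λ r r' → DisjointLeaves (star r) (star r')) rs
    apart []         []        = []
    apart (fr ∷ frs) (r≢ ∷ u) = All.zipWith (λ (fr' , r≢r') → distinct-apart fr fr' r≢r') (frs , r≢) ∷ apart frs u

  witness-unique : UniqueLeaves witness
  witness-unique = uniqueLeaves-node (home-unique ∷ All.map⁺ (All.universal star-unique foreigns))
                                     (All.map⁺ home-apart ∷ AllPairs.map⁺ stars-apart)

  rep-foreign : ∀ {z} → ¬ Component E σ x z → rep z ∈ foreigns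
  rep-foreign {z} x≁z =
    ∈-filterFin⁺ foreign? ((λ x~r → x≁z (x~r ◅◅ Component-sym E σ (rep-component z))) , rep-canonical z)

  witness-leaf : ∀ z → z ∈ᵗ witness
  witness-leaf z with K? x z
  ... | yes x~z = ∈ᵗ-node⁺ (here (proj₂ (home-≐ z) x~z))
  ... | no  x≁z =
    ∈ᵗ-node⁺ (there (Any.map⁺ (lose (rep-foreign x≁z) (proj₂ (star-≐ (rep z) z) (Component-sym E σ (rep-component z))))))

  witness-leafSet : LeafSetIsV witness
  witness-leafSet z = witness-leaf z , witness-unique z

  outsider : ∃[ z ] ¬ Component E σ x z
  outsider with K? x z₀
  ... | no  x≁z₀ = z₀ , x≁z₀
  ... | yes x~z₀ = z₁ , λ x~z₁ → z₀≁z₁ (Component-sym E σ x~z₀ ◅◅ x~z₁)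

  witness-phylogenetic : Phylogenetic witness
  witness-phylogenetic = phylogenetic-node (∈-map⁺ star (rep-foreign (proj₂ outsider)))
    (home-phylogenetic ∷ All.map⁺ (All.universal (λ r → phylogenetic-join-leaves (members-∈ {r} ε)) foreigns))
    where
    leaves-phylogenetic : ∀ l → All Phylogenetic (map leaf l)
    leaves-phylogenetic l = All.map⁺ (All.universal phylogenetic-leaf l)

    home-phylogenetic : Phylogenetic home
    home-phylogenetic = phylogenetic-join
      (phylogenetic-join (phylogenetic-leaf x ∷ leaves-phylogenetic targets) ∷ leaves-phylogenetic others)

  child-block : ∀ {i S a} → subtree witness (i ∷ []) ≡ just S → (_∈ᵗ S) ≐ Component E σ a →
                Cluster witness (i ∷ []) ≐ Component E σ a
  child-block {i} i↦S = ≐-trans (λ y → cluster-∈ᵗ witness (i ∷ []) i↦S)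

  blocks : ∀ v → ChildOfRoot witness v → IsBlock E σ (Cluster witness v)
  blocks .(zero ∷ [])  (zero  , refl , _ , refl) = x , child-block refl home-≐
  blocks .(suc j ∷ []) (suc j , refl , S , j↦S) with subtreeL-map⁻ star foreigns j [] j↦S
  ... | r , _ , refl = r , child-block j↦S (star-≐ r)

  cover : ∀ z → ∃[ v ] (ChildOfRoot witness v × Cluster witness v ≐ Component E σ z)
  cover z with K? x z
  ... | yes x~z = zero ∷ [] , (zero , refl , home , refl) , child-block refl (≐-trans home-≐ (Component-≐ E σ x~z))
  ... | no  x≁z =
    let (j , j↦) = subtreeL-map⁺ star (rep-foreign x≁z)
    in suc j ∷ [] , (suc j , refl , star (rep z) , j↦ []) ,
       child-block (j↦ []) (≐-trans (star-≐ (rep z)) (Component-≐ E σ (Component-sym E σ (rep-component z))))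

  witness-∈𝒯 : InTV E σ witness
  witness-∈𝒯 = witness-phylogenetic , witness-leafSet , blocks , cover

  module W = LeafAddresses witness witness-leafSet

  innerAddr : List ℕ
  innerAddr = zero ∷ proj₁ (join-head inner (map leaf others))

  innerAddr↦ : subtree witness innerAddr ≡ just inner
  innerAddr↦ = proj₂ (join-head inner (map leaf others))

  lca-below-inner : ∀ {y} → W.lca x y ≼ innerAddr → y ≡ x ⊎ Target y
  lca-below-inner {y} lca≼ =
    let (s , addr≡) = ≼-trans (≼-lcpʳ (W.addr x) (W.addr y)) lca≼
    in inner-leaves⁻ (s , trans (sym (subtree-++ witness innerAddr s innerAddr↦))
                                (subst (LeafAt witness y) addr≡ (W.addr-leafAt y)))

  lca-target : ∀ {b} → Target b → W.lca x b ≡ innerAddr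
  lca-target {b} tb = begin
    lcp (W.addr x) (W.addr b)                              ≡⟨ cong₂ lcp (sym (W.leafAt⇒addr {x} {innerAddr ++ zero ∷ []} x-at))
                                                                   (sym (W.leafAt⇒addr {b} {innerAddr ++ suc j ∷ []} b-at)) ⟩
    lcp (innerAddr ++ zero ∷ []) (innerAddr ++ suc j ∷ []) ≡⟨ lcp-++ innerAddr (zero ∷ []) (suc j ∷ []) ⟩
    innerAddr ++ lcp (zero ∷ []) (suc j ∷ [])              ≡⟨ cong (innerAddr ++_) (lcp-∷-≢ {zero} {suc j} [] [] (λ ())) ⟩
    innerAddr ++ []                                        ≡⟨ ++-identityʳ innerAddr ⟩
    innerAddr                                              ∎
    where
    open ≡-Reasoning
    b∈ : b ∈ targets
    b∈ = ∈-filterFin⁺ target? tb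

    j : ℕ
    j = proj₁ (subtreeL-map⁺ leaf b∈)

    below-inner : ∀ q → subtree witness (innerAddr ++ q) ≡ subtree (node (leaf x ∷ map leaf targets)) q
    below-inner q = trans (subtree-++ witness innerAddr q innerAddr↦)
                          (cong (λ t → subtree t q) (join-node (leaf x) (∈-map⁺ leaf b∈)))

    x-at : LeafAt witness x (innerAddr ++ zero ∷ [])
    x-at = below-inner (zero ∷ [])

    b-at : LeafAt witness b (innerAddr ++ suc j ∷ [])
    b-at = trans (below-inner (suc j ∷ [])) (proj₂ (subtreeL-map⁺ leaf b∈) [])

  lca-foreign : ∀ {b} → ¬ Component E σ x b → W.lca x b ≡ []
  lca-foreign {b} x≁b with W.addr b | W.addr-leafAt b
  ... | zero ∷ q  | b-at = ⊥-elim (x≁b (proj₁ (home-≐ b) (q , b-at)))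
  ... | suc i ∷ q | _    =
    let (q₀ , x-at) = proj₂ (home-≐ x) ε
    in trans (cong (λ p → lcp p (suc i ∷ q)) (sym (W.leafAt⇒addr {x} {zero ∷ q₀} x-at))) (lcp-∷-≢ {zero} {suc i} q₀ q λ ())

  arc-kept : E x y₀ → BestMatch witness σ x y₀
  arc-kept Exy₀ = W.lca≼⇒bestMatch σ σx≢σy₀ (closest (K? x y₀))
    where
    σx≢σy₀ : σ x ≢ σ y₀
    σx≢σy₀ = explains⇒properlyColoured explains Exy₀

    inner-above : ∀ y' → σ y' ≡ σ y₀ → W.addr x ≼ innerAddr → innerAddr ≼ W.lca x y'
    inner-above y' e x-below with ancestors-comparable innerAddr (W.lca x y') x-below (≼-lcpˡ _ _)
    ... | inj₁ above = above
    ... | inj₂ below with lca-below-inner below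
    ...   | inj₁ refl = ⊥-elim (σx≢σy₀ e)
    ...   | inj₂ ty'  = subst (innerAddr ≼_) (sym (lca-target ty')) ≼-refl

    closest : Dec (Component E σ x y₀) → ∀ y' → σ y' ≡ σ y₀ → W.lca x y₀ ≼ W.lca x y'
    closest (no x≁y₀) y' e =
      subst₂ _≼_ (sym (lca-foreign x≁y₀)) (sym (lca-foreign (sameColour-outside E σ Exy₀ σx≢σy₀ e x≁y₀))) ≼-refl
    closest (yes x~y₀) y' e =
      let lca≡inner = lca-target (x~y₀ , refl , Exy₀)
      in subst (_≼ W.lca x y') (sym lca≡inner) (inner-above y' e (subst (W.addr x ≼_) lca≡inner (≼-lcpˡ _ _)))

  -- x's best match m of colour σ y₀ in T gives the informative triple xm|y₀.
  target-of-colour : ¬ E x y₀ → σ x ≢ σ y₀ → ∃[ m ] Target m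
  target-of-colour ¬Exy₀ σx≢σy₀ =
    let (m , σm≡σy₀ , x→m) = LeafAddresses.bestMatch-exists T leafSet σ σ? x y₀ σx≢σy₀ refl
        Exm = proj₂ (explains x m) x→m
    in m , (y₀ , inj₁ (inj₁ (proj₁ x→m , σm≡σy₀ , Exm , ¬Exy₀))) ◅ ε , σm≡σy₀ , Exm

  no-arc-created : ¬ E x y₀ → ¬ BestMatch witness σ x y₀
  no-arc-created ¬Exy₀ x→y₀ =
    let (m , tm) = target-of-colour ¬Exy₀ (proj₁ x→y₀)
        lca≼inner = subst (W.lca x y₀ ≼_) (lca-target tm) (W.bestMatch⇒lca≼ σ x→y₀ (proj₁ (proj₂ tm)))
    in Sum.[ (λ y₀≡x → proj₁ x→y₀ (cong σ (sym y₀≡x))) , (λ ty₀ → ¬Exy₀ (proj₂ (proj₂ ty₀))) ]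
             (lca-below-inner lca≼inner)

  witness-agrees : ¬ InU-T E σ witness x y₀
  witness-agrees (inj₁ (Exy₀ , ¬x→y₀)) = ¬x→y₀ (arc-kept Exy₀)
  witness-agrees (inj₂ (¬Exy₀ , x→y₀)) = no-arc-created ¬Exy₀ x→y₀

¬¬-∀Fin : ∀ {n} {P : Fin n → Set} → (∀ i → ¬ ¬ P i) → ¬ ¬ (∀ i → P i)
¬¬-∀Fin {zero}  _   k = k λ ()
¬¬-∀Fin {suc n} ¬¬P k = ¬¬P zero λ p₀ → ¬¬-∀Fin (¬¬P ∘ suc) λ ps → k λ { zero → p₀ ; (suc i) → ps i }

-- The goal is negative, so the decisions needed to build the witness tree may be taken classically.
costZero : ∀ {n} {C : Set} (E : Arcs n) (σ : Fin n → C) {T : Tree n} → LeafSetIsV T → Explains T E σ →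
           ∀ {z₀ z₁} → ¬ Component E σ z₀ z₁ → CostZero E σ
costZero E σ {T} leafSet explains {z₀} {z₁} z₀≁z₁ x y₀ x→y₀∈U =
  ¬¬-∀Fin (λ a → ¬¬-∀Fin (λ b → ¬¬-excluded-middle)) λ K? →
  ¬¬-∀Fin (λ b → ¬¬-excluded-middle) λ σ? →
  ¬¬-∀Fin (λ b → ¬¬-excluded-middle) λ E? →
  let open Witness E σ T leafSet explains z₀ z₁ z₀≁z₁ x y₀ K? σ? E?
  in witness-agrees (x→y₀∈U witness witness-∈𝒯)

binaryRoot : ∀ {n} (T : Tree n) → Binary T → LeafSetIsV T → 2 ≤ n →
             ∃₂ λ t₀ t₁ → T ≡ node (t₀ ∷ t₁ ∷ [])
binaryRoot (leaf a) _ leafSet (s≤s (s≤s _))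
  with trans (∈ᵗ-leaf (proj₁ (leafSet zero))) (sym (∈ᵗ-leaf (proj₁ (leafSet (suc zero)))))
... | ()
binaryRoot (node (t₀ ∷ t₁ ∷ [])) _ _ _ = t₀ , t₁ , refl
binaryRoot (node [])                binary _ _ with binary [] [] refl
... | ()
binaryRoot (node (_ ∷ []))          binary _ _ with binary [] _ refl
... | ()
binaryRoot (node (_ ∷ _ ∷ _ ∷ _))   binary _ _ with binary [] _ refl
... | ()

corollary5 : (n : ℕ) (C : Set) (E : Arcs n) (σ : Fin n → C) →
    BinaryExplainableBMG E σ → 2 ≤ n →
    AtLeastTwoBlocks E σ × CostZero E σ
corollary5 n C E σ (T , phylogenetic , binary , leafSet , explains) 2≤n with binaryRoot T binary leafSet 2≤n
... | t₀ , t₁ , refl =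
  let (z₀ , z₁ , z₀≁z₁) = BinaryRoot.separated E σ t₀ t₁ phylogenetic leafSet explains
  in separated⇒atLeastTwoBlocks E σ z₀≁z₁ , costZero E σ leafSet explains z₀≁z₁
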